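{- Over an alphabet with as many characters as needed, the LZ-End factorization size $\mathit{z}_{End}$ satisfies, for each $\mathrm{x}\in\{\mathrm{sub},\mathrm{ins},\mathrm{del}\}$: $\liminf_{n\to\infty}\mathsf{MS}_{\mathrm{x}}(\mathit{z}_{End},n)\ge 2$, $\mathsf{AS}_{\mathrm{x}}(\mathit{z}_{End},n)\ge\mathit{z}_{End}-\Theta(\sqrt{\mathit{z}_{End}})$ and $\mathsf{AS}_{\mathrm{x}}(\mathit{z}_{End},n)=\Omega(\sqrt n)$. Here $\mathsf{AS}_{\mathrm{x}}\ge \mathit{z}_{End}-\Theta(\sqrt{\mathit{z}_{End}})$ means: there are a constant $c$ and strings $T$ with $\mathit{z}_{End}(T)$ arbitrarily large, each with a string $T'$ obtained by one edit of type $\mathrm{x}$, such that $\mathit{z}_{End}(T')-\mathit{z}_{End}(T)\ge \mathit{z}_{End}(T)-c\sqrt{\mathit{z}_{End}(T)}$.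
   Context: The LZ-End factorization of a nonempty string $T$ is $T=f_1\cdots f_z$ defined greedily left to right: for each $i$, let $u$ be the longest prefix of the remaining suffix $f_i\cdots f_z$ that occurs as a suffix of one of the strings $\varepsilon, f_1, f_1f_2,\ldots,f_1\cdots f_{i-1}$; if $u$ is the whole remaining suffix then $f_i=u$ is the last factor, otherwise $f_i=uc$ with $c$ the next character. $\mathit{z}_{End}(T)=z$. $\mathsf{ed}$ is edit distance; $\mathsf{MS}_{\mathrm{sub}}(C,n)=\sup\{C(T')/C(T):T\in\Sigma^n,T'\in\Sigma^n,\mathsf{ed}(T,T')=1\}$, with $T'\in\Sigma^{n+1}$ (ins) or $\Sigma^{n-1}$ (del); $\mathsf{AS}$ analogously with differences. -}

module Defs where

open import Data.Nat using (ℕ; zero; suc; _+_; _≡ᵇ_)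
open import Data.Bool using (Bool; true; false; _∧_; _∨_; if_then_else_)
open import Data.List using (List; []; _∷_; _++_; length; take; drop; reverse; [_])
open import Data.Product using (∃-syntax; _×_)
open import Relation.Binary.PropositionalEquality using (_≡_)
open import Relation.Nullary using (¬_)

-- Strings over the alphabet ℕ (an alphabet with as many characters as needed).
Str : Set
Str = List ℕ

isPrefixᵇ : Str → Str → Bool
isPrefixᵇ []       _        = true
isPrefixᵇ (_ ∷ _)  []       = false
isPrefixᵇ (x ∷ xs) (y ∷ ys) = (x ≡ᵇ y) ∧ isPrefixᵇ xs ys

isSuffixᵇ : Str → Str → Bool
isSuffixᵇ u p = isPrefixᵇ (reverse u) (reverse p)

suffixOfSomeᵇ : Str → List Str → Bool
suffixOfSomeᵇ u []       = false
suffixOfSomeᵇ u (p ∷ ps) = isSuffixᵇ u p ∨ suffixOfSomeᵇ u ps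

longestFrom : List Str → Str → ℕ → ℕ
longestFrom ps S zero    = zero
longestFrom ps S (suc ℓ) =
  if suffixOfSomeᵇ (take (suc ℓ) S) ps then suc ℓ else longestFrom ps S ℓ

-- Greedy LZ-End factorization.
--   fuel : recursion bound (each phrase consumes at least one character)
--   done : f₁⋯f_{i-1}
--   ps   : the list ε, f₁, f₁f₂, …, f₁⋯f_{i-1}
--   S    : the remaining suffix
-- returns the list of phrases f_i, …, f_z
lzEndGo : ℕ → Str → List Str → Str → List Str
lzEndGo _          done ps []      = []
lzEndGo zero       done ps (c ∷ S) = (c ∷ S) ∷ []   -- unreachable with enough fuel
lzEndGo (suc fuel) done ps (c ∷ S) =
  let S₀ = c ∷ S
      k  = longestFrom ps S₀ (length S₀)
  in if k ≡ᵇ length S₀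
     then S₀ ∷ []
     else (take (suc k) S₀ ∷
           lzEndGo fuel (done ++ take (suc k) S₀)
                        (ps ++ [ done ++ take (suc k) S₀ ])
                        (drop (suc k) S₀))

lzEnd : Str → List Str
lzEnd T = lzEndGo (length T) [] ([] ∷ []) T

zEnd : Str → ℕ
zEnd T = length (lzEnd T)

data EditOp : Set where
  sub ins del : EditOp

-- OneEdit x T T' : T' is obtained from T by exactly one edit of type x
-- (equivalently ed(T,T') = 1 with |T'| = |T|, |T|+1, |T|-1 respectively).
OneEdit : EditOp → Str → Str → Set
OneEdit sub T T' = ∃[ u ] ∃[ a ] ∃[ b ] ∃[ v ]
  (¬ a ≡ b × T ≡ u ++ (a ∷ v) × T' ≡ u ++ (b ∷ v))
OneEdit ins T T' = ∃[ u ] ∃[ c ] ∃[ v ] (T ≡ u ++ v × T' ≡ u ++ (c ∷ v))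
OneEdit del T T' = ∃[ u ] ∃[ c ] ∃[ v ] (T ≡ u ++ (c ∷ v) × T' ≡ u ++ v)

-- The texts are  D $ B₁ #₁ B₂ #₂ ⋯ B_{A²} #_{A²} P  where D = 1 2 ⋯ 2A is a dictionary,
-- $ and the #ᵢ are pairwise distinct fresh symbols, the blocks Bᵢ are the A² intervals [a, b]
-- of D with a ≤ A < b, and P, a suffix of everything before it, adjusts the length.
-- LZ-End parses D symbol by symbol, so every prefix of D ends a phrase; each Bᵢ is a suffix
-- of such a prefix, so Bᵢ #ᵢ is a single phrase, and P costs at most one more:
-- z_End = A² + 2A + O(1).  An edit at the middle of D (deleting or substituting A + 1, or
-- inserting between A and A + 1) leaves a dictionary containing no block.  As a phrase only
-- copies earlier text, and the blocks are ordered so that none occurs in the earlier ones,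
-- every Bᵢ #ᵢ now needs two phrases: z_End ≥ 2A² + 1.  With n = Θ(A³) all three bounds follow.

module Submission where

open import Defs
open import Data.Bool using (true; false; T)
open import Data.Bool.Properties using (∧-conicalˡ; ∧-conicalʳ)
open import Data.Empty using (⊥-elim)
open import Data.List using (List; []; _∷_; _++_; length; take; drop; reverse; [_]; map)
open import Data.List.Membership.Propositional using (_∈_; _∉_)
open import Data.List.Membership.Propositional.Properties using (∈-++⁺ˡ; ∈-++⁺ʳ; ∈-++⁻)
open import Data.List.Properties
  using (++-assoc; ++-identityʳ; ∷-injective; length-++; length-drop; map-++;
         reverse-++; reverse-involutive; take++drop≡id; take-all)
open import Data.List.Relation.Unary.Any using (here; there)
open import Data.Nat using (ℕ; zero; suc; _+_; _*_; _∸_; _^_; _≤_; _<_; z≤n; s≤s; z<s; _≡ᵇ_)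
open import Data.Nat.ListAction using (sum)
open import Data.Nat.ListAction.Properties using (sum-++)
open import Data.Nat.Properties
open import Data.Nat.Tactic.RingSolver using (solve-∀)
open import Data.Product using (∃-syntax; _×_; _,_; proj₂; map₁; map₂)
open import Data.Sum using (_⊎_; inj₁; inj₂)
open import Data.Unit using (⊤; tt)
open import Relation.Binary.PropositionalEquality hiding ([_])
open import Relation.Nullary using (¬_; yes; no)

Infix : Str → Str → Set
Infix u w = ∃[ A ] ∃[ B ] (w ≡ A ++ u ++ B)

SuffixOfSome : Str → List Str → Set
SuffixOfSome u ps = ∃[ p ] (p ∈ ps × ∃[ q ] (p ≡ q ++ u))

∈-Infix : ∀ {u w y} → Infix u w → y ∈ u → y ∈ w
∈-Infix (A , _ , refl) y∈u = ∈-++⁺ʳ A (∈-++⁺ˡ y∈u)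

prefix-before-fresh : ∀ (w Q X : Str) y Y → w ++ Q ≡ X ++ y ∷ Y → y ∉ w → ∃[ Q' ] (X ≡ w ++ Q')
prefix-before-fresh []      Q X       y Y eq y∉ = X , refl
prefix-before-fresh (z ∷ w) Q []      y Y refl y∉ = ⊥-elim (y∉ (here refl))
prefix-before-fresh (z ∷ w) Q (x ∷ X) y Y eq y∉
  with refl , eq′ ← ∷-injective eq
  with Q' , refl ← prefix-before-fresh w Q X y Y eq′ (λ m → y∉ (there m)) = Q' , refl

Infix-split : ∀ w X y Y → Infix w (X ++ y ∷ Y) → y ∉ w → Infix w X ⊎ Infix w Y
Infix-split w []      y Y ([] , Q , eq) y∉ with w | eq
... | []    | _    = inj₁ ([] , [] , refl)
... | _ ∷ _ | refl = ⊥-elim (y∉ (here refl))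
Infix-split w []      y Y (_ ∷ P , Q , refl) y∉ = inj₂ (P , Q , refl)
Infix-split w (x ∷ X) y Y ([] , Q , eq) y∉ =
  inj₁ ([] , prefix-before-fresh w Q (x ∷ X) y Y (sym eq) y∉)
Infix-split w (x ∷ X) y Y (_ ∷ P , Q , eq) y∉
  with Infix-split w X y Y (P , Q , proj₂ (∷-injective eq)) y∉
... | inj₁ (P' , Q' , e) = inj₁ (x ∷ P' , Q' , cong (x ∷_) e)
... | inj₂ w⊑Y           = inj₂ w⊑Y

split-before-fresh : ∀ (u : Str) c S A x R → u ++ c ∷ S ≡ A ++ x ∷ R → x ∉ u →
  (A ≡ u × c ≡ x × S ≡ R) ⊎ ∃[ A' ] (A ≡ u ++ c ∷ A' × S ≡ A' ++ x ∷ R)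
split-before-fresh []      c S []      x R refl _  = inj₁ (refl , refl , refl)
split-before-fresh []      c S (_ ∷ A) x R refl _  = inj₂ (A , refl , refl)
split-before-fresh (v ∷ u) c S []      x R refl x∉ = ⊥-elim (x∉ (here refl))
split-before-fresh (v ∷ u) c S (_ ∷ A) x R eq   x∉
  with refl , eq′ ← ∷-injective eq
  with split-before-fresh u c S A x R eq′ (λ m → x∉ (there m))
... | inj₁ (refl , c≡x , S≡R) = inj₁ (refl , c≡x , S≡R)
... | inj₂ (A' , refl , S≡)   = inj₂ (A' , refl , S≡)

separated : ℕ → List Str → Str
separated s []       = []
separated s (w ∷ ws) = w ++ s ∷ separated (suc s) ws

++-separated : ∀ (done w : Str) s ws → (done ++ w ++ [ s ]) ++ separated (suc s) ws ≡ done ++ separated s (w ∷ ws)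
++-separated done w s ws = begin
  (done ++ w ++ [ s ]) ++ separated (suc s) ws ≡⟨ ++-assoc done (w ++ [ s ]) _ ⟩
  done ++ (w ++ [ s ]) ++ separated (suc s) ws ≡⟨ cong (done ++_) (++-assoc w [ s ] _) ⟩
  done ++ separated s (w ∷ ws)                 ∎
  where open ≡-Reasoning

separated-upper : ∀ s ws → (∀ {w} → w ∈ ws → ∀ {y} → y ∈ w → y < s) →
  ∀ {y} → y ∈ separated s ws → y < s + length ws
separated-upper s (w ∷ ws) ws<s {y} y∈ with ∈-++⁻ w y∈
... | inj₁ y∈w          = ≤-trans (ws<s (here refl) y∈w) (m≤m+n s _)
... | inj₂ (here refl)  = m<m+n s z<s
... | inj₂ (there y∈′) rewrite +-suc s (length ws) =
  separated-upper (suc s) ws (λ w∈ y∈w → m≤n⇒m≤1+n (ws<s (there w∈) y∈w)) y∈′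

Infix-separated : ∀ w s ws → Infix w (separated s ws) → (∀ {y} → y ∈ w → y < s) → ∃[ y ] (y ∈ w) →
  ∃[ v ] (v ∈ ws × Infix w v)
Infix-separated w s []       w⊑ _   (y , y∈) with () ← ∈-Infix w⊑ y∈
Infix-separated w s (v ∷ ws) w⊑ w<s y∈w
  with Infix-split w v s (separated (suc s) ws) w⊑ (λ s∈ → <-irrefl refl (w<s s∈))
... | inj₁ w⊑v = v , here refl , w⊑v
... | inj₂ w⊑rest
  with v′ , v′∈ , w⊑v′ ← Infix-separated w (suc s) ws w⊑rest (λ y∈ → m≤n⇒m≤1+n (w<s y∈)) y∈w =
  v′ , there v′∈ , w⊑v′

≡ᵇ-refl : ∀ n → (n ≡ᵇ n) ≡ true
≡ᵇ-refl zero    = refl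
≡ᵇ-refl (suc n) = ≡ᵇ-refl n

isPrefixᵇ-sound : ∀ xs ys → isPrefixᵇ xs ys ≡ true → ∃[ s ] (ys ≡ xs ++ s)
isPrefixᵇ-sound []       ys       _ = ys , refl
isPrefixᵇ-sound (x ∷ xs) (y ∷ ys) e
  with refl ← ≡ᵇ⇒≡ x y (subst T (sym (∧-conicalˡ _ _ e)) _)
  with s , refl ← isPrefixᵇ-sound xs ys (∧-conicalʳ (x ≡ᵇ y) _ e) = s , refl

isPrefixᵇ-complete : ∀ xs s → isPrefixᵇ xs (xs ++ s) ≡ true
isPrefixᵇ-complete []       s = refl
isPrefixᵇ-complete (x ∷ xs) s rewrite ≡ᵇ-refl x = isPrefixᵇ-complete xs s

isSuffixᵇ-sound : ∀ u p → isSuffixᵇ u p ≡ true → ∃[ q ] (p ≡ q ++ u)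
isSuffixᵇ-sound u p e with s , eq ← isPrefixᵇ-sound (reverse u) (reverse p) e = reverse s , (begin
  p                                ≡⟨ reverse-involutive p ⟨
  reverse (reverse p)              ≡⟨ cong reverse eq ⟩
  reverse (reverse u ++ s)         ≡⟨ reverse-++ (reverse u) s ⟩
  reverse s ++ reverse (reverse u) ≡⟨ cong (reverse s ++_) (reverse-involutive u) ⟩
  reverse s ++ u                   ∎)
  where open ≡-Reasoning

isSuffixᵇ-complete : ∀ q u → isSuffixᵇ u (q ++ u) ≡ true
isSuffixᵇ-complete q u rewrite reverse-++ q u = isPrefixᵇ-complete (reverse u) (reverse q)

suffixOfSomeᵇ-sound : ∀ u ps → suffixOfSomeᵇ u ps ≡ true → SuffixOfSome u ps
suffixOfSomeᵇ-sound u (p ∷ ps) e with isSuffixᵇ u p in eq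
... | true  = p , here refl , isSuffixᵇ-sound u p eq
... | false with p' , p'∈ , q ← suffixOfSomeᵇ-sound u ps e = p' , there p'∈ , q

suffixOfSomeᵇ-complete : ∀ u ps → SuffixOfSome u ps → suffixOfSomeᵇ u ps ≡ true
suffixOfSomeᵇ-complete u (p ∷ ps) (_ , here refl , q , refl) rewrite isSuffixᵇ-complete q u = refl
suffixOfSomeᵇ-complete u (p ∷ ps) (p' , there p'∈ , s) with isSuffixᵇ u p
... | true  = refl
... | false = suffixOfSomeᵇ-complete u ps (p' , p'∈ , s)

longestFrom-sound : ∀ ps S ℓ → let k = longestFrom ps S ℓ in
  k ≤ ℓ × (k ≡ 0 ⊎ SuffixOfSome (take k S) ps)
longestFrom-sound ps S zero = z≤n , inj₁ refl
longestFrom-sound ps S (suc ℓ) with suffixOfSomeᵇ (take (suc ℓ) S) ps in eq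
... | true  = ≤-refl , inj₂ (suffixOfSomeᵇ-sound _ ps eq)
... | false = map₁ m≤n⇒m≤1+n (longestFrom-sound ps S ℓ)

longestFrom-exact : ∀ ps S K ℓ → K ≤ ℓ →
  (∀ m → K < m → m ≤ ℓ → ¬ SuffixOfSome (take m S) ps) → SuffixOfSome (take K S) ps →
  longestFrom ps S ℓ ≡ K
longestFrom-exact ps S K zero    z≤n _ _ = refl
longestFrom-exact ps S K (suc ℓ) K≤ none ok with K ≟ suc ℓ
... | yes refl rewrite suffixOfSomeᵇ-complete _ ps ok = refl
... | no K≢ with K< ← ≤∧≢⇒< K≤ K≢ with suffixOfSomeᵇ (take (suc ℓ) S) ps in eq
...   | true  = ⊥-elim (none (suc ℓ) K< ≤-refl (suffixOfSomeᵇ-sound _ ps eq))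
...   | false = longestFrom-exact ps S K ℓ (≤-pred K<) (λ m a b → none m a (m≤n⇒m≤1+n b)) ok

take-length : ∀ (w ys : Str) → take (length w) (w ++ ys) ≡ w
take-length []      ys = refl
take-length (y ∷ w) ys = cong (y ∷_) (take-length w ys)

∈-take-beyond : ∀ (w : Str) x R m → length w < m → x ∈ take m (w ++ x ∷ R)
∈-take-beyond []      x R (suc m) _         = here refl
∈-take-beyond (y ∷ w) x R (suc m) (s≤s w<m) = there (∈-take-beyond w x R m w<m)

longestFrom-fresh : ∀ ps w x R ℓ → length w ≤ ℓ → (∀ {p} → p ∈ ps → x ∉ p) → SuffixOfSome w ps →
  longestFrom ps (w ++ x ∷ R) ℓ ≡ length w
longestFrom-fresh ps w x R ℓ w≤ℓ x-fresh w-src =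
  longestFrom-exact ps (w ++ x ∷ R) (length w) ℓ w≤ℓ uncopyable
    (subst (λ u → SuffixOfSome u ps) (sym (take-length w (x ∷ R))) w-src)
  where
  uncopyable : ∀ m → length w < m → m ≤ ℓ → ¬ SuffixOfSome (take m (w ++ x ∷ R)) ps
  uncopyable m w<m _ (p , p∈ , q , refl) = x-fresh p∈ (∈-++⁺ʳ q (∈-take-beyond w x R m w<m))

-- Lower bounds: every phrase copies earlier text

data CopyParse : Str → List Str → Str → Set where
  []    : ∀ {ctx} → CopyParse ctx [] []
  copy∷ : ∀ {ctx u c f fs S} → Infix u ctx → f ≡ u ++ [ c ] → CopyParse (ctx ++ f) fs S →
          CopyParse ctx (f ∷ fs) (f ++ S)
  copy  : ∀ {ctx u} → Infix u ctx → CopyParse ctx (u ∷ []) u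

PrefixesOf : List Str → Str → Set
PrefixesOf ps done = ∀ {p} → p ∈ ps → ∃[ q ] (done ≡ p ++ q)

PrefixesOf-snoc : ∀ {ps done} f → PrefixesOf ps done → PrefixesOf (ps ++ [ done ++ f ]) (done ++ f)
PrefixesOf-snoc {ps} f pre p∈ with ∈-++⁻ ps p∈
... | inj₁ p∈ps with q , refl ← pre p∈ps = q ++ f , ++-assoc _ q f
... | inj₂ (here refl) = [] , sym (++-identityʳ _)

Infix-from-prefixes : ∀ {u ps done} → PrefixesOf ps done → SuffixOfSome u ps → Infix u done
Infix-from-prefixes {u} pre (p , p∈ , q , refl) with r , refl ← pre p∈ = q , r , ++-assoc q u r

take-suc-snoc : ∀ k (xs : Str) → k < length xs → ∃[ x ] (take (suc k) xs ≡ take k xs ++ [ x ])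
take-suc-snoc zero    (x ∷ xs) _         = x , refl
take-suc-snoc (suc k) (x ∷ xs) (s≤s k<) = map₂ (cong (x ∷_)) (take-suc-snoc k xs k<)

lzEndGo-parse : ∀ fuel done ps S → PrefixesOf ps done → length S ≤ fuel →
  CopyParse done (lzEndGo fuel done ps S) S
lzEndGo-parse fuel       done ps []      pre _ = []
lzEndGo-parse (suc fuel) done ps (c ∷ S) pre (s≤s S≤)
  with longestFrom ps (c ∷ S) (suc (length S)) | longestFrom-sound ps (c ∷ S) (suc (length S))
... | k | k≤ , copyable with k ≡ᵇ suc (length S) in eq
... | true rewrite ≡ᵇ⇒≡ k _ (subst T (sym eq) _) with copyable
...   | inj₂ whole rewrite take-all (suc (length S)) (c ∷ S) ≤-refl = copy (Infix-from-prefixes pre whole)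
lzEndGo-parse (suc fuel) done ps (c ∷ S) pre (s≤s S≤) | k | k≤ , copyable | false
  with k< ← ≤∧≢⇒< k≤ (λ k≡ → subst T eq (≡⇒≡ᵇ k _ k≡))
  with x , ext ← take-suc-snoc k (c ∷ S) k< =
  subst (CopyParse done _) (take++drop≡id (suc k) (c ∷ S))
    (copy∷ (source copyable) ext
      (lzEndGo-parse fuel _ _ _ (PrefixesOf-snoc _ pre)
        (≤-trans (≤-reflexive (length-drop k S)) (≤-trans (m∸n≤m (length S) k) S≤))))
  where
  source : k ≡ 0 ⊎ SuffixOfSome (take k (c ∷ S)) ps → Infix (take k (c ∷ S)) done
  source (inj₁ refl) = [] , done , refl
  source (inj₂ s)    = Infix-from-prefixes pre s

lzEnd-parse : ∀ T → CopyParse [] (lzEnd T) T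
lzEnd-parse T = lzEndGo-parse (length T) [] ([] ∷ []) T (λ { (here refl) → [] , refl }) ≤-refl

-- A phrase copies earlier text, so a character occurring nowhere before it can only be
-- its last character: some phrase ends exactly at x, and if A is not an infix of the
-- context the phrases up to x cannot all be one.
CopyParse-split-at-fresh : ∀ {ctx fs S} → CopyParse ctx fs S →
  ∀ A x R → S ≡ A ++ x ∷ R → x ∉ ctx → x ∉ A →
  ∃[ gs ] ∃[ hs ] (fs ≡ gs ++ hs × CopyParse (ctx ++ A ++ [ x ]) hs R
                   × 1 ≤ length gs × (¬ Infix A ctx → 2 ≤ length gs))
CopyParse-split-at-fresh []         []      x R () _ _
CopyParse-split-at-fresh []         (_ ∷ _) x R () _ _
CopyParse-split-at-fresh (copy u⊑)  A x R refl x∉ctx _ =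
  ⊥-elim (x∉ctx (∈-Infix u⊑ (∈-++⁺ʳ A (here refl))))
CopyParse-split-at-fresh {ctx} (copy∷ {u = u} {c} {fs = fs} {S = S} u⊑ refl p) A x R eq x∉ctx x∉A
  with split-before-fresh u c S A x R (trans (sym (++-assoc u [ c ] S)) eq) (λ m → x∉ctx (∈-Infix u⊑ m))
... | inj₁ (refl , refl , refl) = [ u ++ [ c ] ] , fs , refl , p , s≤s z≤n , λ A⋢ → ⊥-elim (A⋢ u⊑)
... | inj₂ (A' , refl , refl)
  with CopyParse-split-at-fresh p A' x R refl x∉ctx′ (λ m → x∉A (∈-++⁺ʳ u (there m)))
  where
  x∉ctx′ : x ∉ ctx ++ u ++ [ c ]
  x∉ctx′ m with ∈-++⁻ ctx m
  ... | inj₁ m₁ = x∉ctx m₁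
  ... | inj₂ m₂ with ∈-++⁻ u m₂
  ...   | inj₁ m₃         = x∉ctx (∈-Infix u⊑ m₃)
  ...   | inj₂ (here refl) = x∉A (∈-++⁺ʳ u (here refl))
... | gs , hs , refl , p′ , gs≥1 , _ =
  (u ++ [ c ]) ∷ gs , hs , refl , subst (λ z → CopyParse z hs R) context-eq p′ , s≤s z≤n , λ _ → s≤s gs≥1
  where
  context-eq : (ctx ++ u ++ [ c ]) ++ A' ++ [ x ] ≡ ctx ++ (u ++ c ∷ A') ++ [ x ]
  context-eq = begin
    (ctx ++ u ++ [ c ]) ++ A' ++ [ x ] ≡⟨ ++-assoc ctx _ _ ⟩
    ctx ++ (u ++ [ c ]) ++ A' ++ [ x ] ≡⟨ cong (ctx ++_) (++-assoc u [ c ] _) ⟩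
    ctx ++ u ++ c ∷ A' ++ [ x ]       ≡⟨ cong (ctx ++_) (++-assoc u (c ∷ A') [ x ]) ⟨
    ctx ++ (u ++ c ∷ A') ++ [ x ]     ∎
    where open ≡-Reasoning

NovelBlocks : Str → ℕ → List Str → Set
NovelBlocks ctx s []       = ⊤
NovelBlocks ctx s (w ∷ ws) = s ∉ ctx × s ∉ w × ¬ Infix w ctx × NovelBlocks (ctx ++ w ++ [ s ]) (suc s) ws

NovelBlocks-snoc : ∀ ctx s xs w → NovelBlocks ctx s xs →
  NovelBlocks (ctx ++ separated s xs) (s + length xs) [ w ] → NovelBlocks ctx s (xs ++ [ w ])
NovelBlocks-snoc ctx s []       w _ novel rewrite ++-identityʳ ctx | +-identityʳ s = novel
NovelBlocks-snoc ctx s (v ∷ xs) w (s∉ , s∉v , v⋢ , novel) novel′ rewrite +-suc s (length xs) =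
  s∉ , s∉v , v⋢ , NovelBlocks-snoc (ctx ++ v ++ [ s ]) (suc s) xs w novel
                     (subst (λ c → NovelBlocks c (suc (s + length xs)) [ w ]) (sym (++-separated ctx v s xs)) novel′)

CopyParse-novel-length : ∀ ws {ctx fs S} s R → CopyParse ctx fs S → S ≡ separated s ws ++ R →
  NovelBlocks ctx s ws → 2 * length ws ≤ length fs
CopyParse-novel-length []       s R p eq novel = z≤n
CopyParse-novel-length (w ∷ ws) s R p eq (s∉ctx , s∉w , w⋢ctx , novel)
  with gs , hs , refl , p′ , _ , two ← CopyParse-split-at-fresh p w s (separated (suc s) ws ++ R)
                                          (trans eq (++-assoc w _ R)) s∉ctx s∉w = begin
  2 * suc (length ws)          ≡⟨ *-suc 2 (length ws) ⟩
  2 + 2 * length ws            ≤⟨ +-mono-≤ (two w⋢ctx) (CopyParse-novel-length ws (suc s) R p′ refl novel) ⟩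
  length gs + length hs        ≡⟨ length-++ gs ⟨
  length (gs ++ hs)            ∎
  where open ≤-Reasoning

-- Upper bounds: exact runs of the algorithm

lzEndGo-step : ∀ f done ps S k → longestFrom ps S (length S) ≡ k → k < length S →
  lzEndGo (suc f) done ps S ≡
    take (suc k) S ∷ lzEndGo f (done ++ take (suc k) S) (ps ++ [ done ++ take (suc k) S ]) (drop (suc k) S)
lzEndGo-step f done ps (c ∷ S) k refl k< with k ≡ᵇ suc (length S) in eq
... | true  = ⊥-elim (<-irrefl (≡ᵇ⇒≡ k _ (subst T (sym eq) _)) k<)
... | false = refl

take-suc-length : ∀ (w : Str) x R → take (suc (length w)) (w ++ x ∷ R) ≡ w ++ [ x ]
take-suc-length []      x R = refl
take-suc-length (y ∷ w) x R = cong (y ∷_) (take-suc-length w x R)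

drop-suc-length : ∀ (w : Str) x R → drop (suc (length w)) (w ++ x ∷ R) ≡ R
drop-suc-length []      x R = refl
drop-suc-length (y ∷ w) x R = drop-suc-length w x R

length-<-++-∷ : ∀ (w : Str) x R → length w < length (w ++ x ∷ R)
length-<-++-∷ w x R = subst (length w <_) (sym (length-++ w)) (m<m+n (length w) z<s)

lzEndGo-fresh-step : ∀ f done ps w x R → (∀ {p} → p ∈ ps → x ∉ p) → SuffixOfSome w ps →
  lzEndGo (suc f) done ps (w ++ x ∷ R) ≡
    (w ++ [ x ]) ∷ lzEndGo f (done ++ w ++ [ x ]) (ps ++ [ done ++ w ++ [ x ] ]) R
lzEndGo-fresh-step f done ps w x R x-fresh w-src = begin
  lzEndGo (suc f) done ps S
    ≡⟨ lzEndGo-step f done ps S (length w)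
         (longestFrom-fresh ps w x R (length S) (<⇒≤ (length-<-++-∷ w x R)) x-fresh w-src)
         (length-<-++-∷ w x R) ⟩
  take (suc (length w)) S ∷ lzEndGo f (done ++ take (suc (length w)) S)
                                      (ps ++ [ done ++ take (suc (length w)) S ]) (drop (suc (length w)) S)
    ≡⟨ cong₂ (λ φ S′ → φ ∷ lzEndGo f (done ++ φ) (ps ++ [ done ++ φ ]) S′)
             (take-suc-length w x R) (drop-suc-length w x R) ⟩
  (w ++ [ x ]) ∷ lzEndGo f (done ++ w ++ [ x ]) (ps ++ [ done ++ w ++ [ x ] ]) R ∎
  where
  open ≡-Reasoning
  S : Str
  S = w ++ x ∷ R

range : ℕ → ℕ → Str
range s zero    = []
range s (suc l) = s ∷ range (suc s) l

length-range : ∀ s l → length (range s l) ≡ l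
length-range s zero    = refl
length-range s (suc l) = cong suc (length-range (suc s) l)

range-++ : ∀ s l m → range s (l + m) ≡ range s l ++ range (s + l) m
range-++ s zero    m rewrite +-identityʳ s = refl
range-++ s (suc l) m rewrite +-suc s l = cong (s ∷_) (range-++ (suc s) l m)

range-snoc : ∀ s l → range s l ++ [ s + l ] ≡ range s (suc l)
range-snoc s l = begin
  range s l ++ range (s + l) 1 ≡⟨ range-++ s l 1 ⟨
  range s (l + 1)              ≡⟨ cong (range s) (+-comm l 1) ⟩
  range s (suc l)              ∎
  where open ≡-Reasoning

range-lower : ∀ s l {y} → y ∈ range s l → s ≤ y
range-lower s (suc l) (here refl) = ≤-refl
range-lower s (suc l) (there y∈)  = <⇒≤ (range-lower (suc s) l y∈)

range-upper : ∀ s l {y} → y ∈ range s l → y < s + l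
range-upper s (suc l) (here refl) = m<m+n s z<s
range-upper s (suc l) {y} (there y∈) rewrite +-suc s l = range-upper (suc s) l y∈

∈-range : ∀ s l {y} → s ≤ y → y < s + l → y ∈ range s l
∈-range s zero    s≤y y< = ⊥-elim (<-irrefl refl (≤-<-trans s≤y (subst (_ <_) (+-identityʳ s) y<)))
∈-range s (suc l) {y} s≤y y< with s ≟ y
... | yes refl = here refl
... | no s≢y   = there (∈-range (suc s) l (≤∧≢⇒< s≤y s≢y) (subst (y <_) (+-suc s l) y<))

AllBelow : ℕ → List Str → Set
AllBelow s ps = ∀ {p} → p ∈ ps → ∀ {y} → y ∈ p → y < s

AllBelow-snoc : ∀ {s ps p} → AllBelow s ps → (∀ {y} → y ∈ p → y < suc s) → AllBelow (suc s) (ps ++ [ p ])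
AllBelow-snoc {ps = ps} below p< q∈ y∈ with ∈-++⁻ ps q∈
... | inj₁ q∈ps        = m≤n⇒m≤1+n (below q∈ps y∈)
... | inj₂ (here refl) = p< y∈

AllBelow⇒fresh : ∀ {s ps p} → AllBelow s ps → p ∈ ps → s ∉ p
AllBelow⇒fresh below p∈ s∈ = <-irrefl refl (below p∈ s∈)

PrefixesUpTo : ℕ → List Str → Set
PrefixesUpTo M ps = ∀ t → t ≤ M → range 1 t ∈ ps

PrefixesUpTo-snoc : ∀ {K ps} → PrefixesUpTo K ps → PrefixesUpTo (suc K) (ps ++ [ range 1 (suc K) ])
PrefixesUpTo-snoc {K} {ps} pre t t≤ with t ≟ suc K
... | yes refl = ∈-++⁺ʳ ps (here refl)
... | no t≢    = ∈-++⁺ˡ (pre t (≤-pred (≤∧≢⇒< t≤ t≢)))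

fuel-pred : ∀ {f} (w : Str) x R → length (w ++ x ∷ R) ≤ f → ∃[ f₁ ] (f ≡ suc f₁ × length R ≤ f₁)
fuel-pred w x R le with m+n≤o⇒n≤o (length w) (≤-trans (≤-reflexive (sym (length-++ w))) le)
... | s≤s R≤ = _ , refl , R≤

lzEndGo-range : ∀ L K f ps R → AllBelow (suc K) ps → PrefixesUpTo K ps → length (range (suc K) L ++ R) ≤ f →
  ∃[ f′ ] ∃[ ps′ ] (length (lzEndGo f (range 1 K) ps (range (suc K) L ++ R))
                      ≡ L + length (lzEndGo f′ (range 1 (K + L)) ps′ R)
                    × AllBelow (suc (K + L)) ps′ × PrefixesUpTo (K + L) ps′ × length R ≤ f′)
lzEndGo-range zero    K f ps R below pre R≤ rewrite +-identityʳ K = f , ps , refl , below , pre , R≤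
lzEndGo-range (suc L) K f ps R below pre le
  with f₁ , refl , le′ ← fuel-pred [] (suc K) (range (suc (suc K)) L ++ R) le
  rewrite lzEndGo-fresh-step f₁ (range 1 K) ps [] (suc K) (range (suc (suc K)) L ++ R)
            (AllBelow⇒fresh below) ([] , pre 0 z≤n , [] , refl)
        | range-snoc 1 K
  with f′ , ps′ , eq , below′ , pre′ , R≤ ← lzEndGo-range L (suc K) f₁ (ps ++ [ range 1 (suc K) ]) R
         (AllBelow-snoc below (range-upper 1 (suc K))) (PrefixesUpTo-snoc pre) le′
  rewrite +-suc K L = f′ , ps′ , cong suc eq , below′ , pre′ , R≤

DictSuffix : ℕ → Str → Set
DictSuffix M w = ∃[ t ] (t ≤ M × ∃[ q ] (range 1 t ≡ q ++ w))

DictSuffix⇒≤ : ∀ {M w y} → DictSuffix M w → y ∈ w → y ≤ M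
DictSuffix⇒≤ (t , t≤M , q , eq) y∈ =
  ≤-trans (≤-pred (range-upper 1 t (subst (_ ∈_) (sym eq) (∈-++⁺ʳ q y∈)))) t≤M

lzEndGo-separated : ∀ M ws s f done ps R → M < s → AllBelow s ps → PrefixesUpTo M ps → done ∈ ps →
  (∀ {w} → w ∈ ws → DictSuffix M w) → length (separated s ws ++ R) ≤ f →
  ∃[ f′ ] ∃[ ps′ ] (length (lzEndGo f done ps (separated s ws ++ R))
                      ≡ length ws + length (lzEndGo f′ (done ++ separated s ws) ps′ R)
                    × done ++ separated s ws ∈ ps′ × length R ≤ f′)
lzEndGo-separated M [] s f done ps R _ _ _ done∈ _ R≤ rewrite ++-identityʳ done = f , ps , refl , done∈ , R≤
lzEndGo-separated M (w ∷ ws) s f done ps R M<s below pre done∈ dict le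
  rewrite ++-assoc w (s ∷ separated (suc s) ws) R
  with f₁ , refl , le′ ← fuel-pred w s (separated (suc s) ws ++ R) le
  with t , t≤M , q , w-suffix ← dict (here refl)
  rewrite lzEndGo-fresh-step f₁ done ps w s (separated (suc s) ws ++ R)
            (AllBelow⇒fresh below) (range 1 t , pre t t≤M , q , w-suffix)
  with lzEndGo-separated M ws (suc s) f₁ (done ++ w ++ [ s ]) (ps ++ [ done ++ w ++ [ s ] ]) R
         (m≤n⇒m≤1+n M<s) (AllBelow-snoc below phrase<) (λ t t≤ → ∈-++⁺ˡ (pre t t≤))
         (∈-++⁺ʳ ps (here refl)) (λ w∈ → dict (there w∈)) le′
  where
  phrase< : ∀ {y} → y ∈ done ++ w ++ [ s ] → y < suc s
  phrase< y∈ with ∈-++⁻ done y∈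
  ... | inj₁ y∈done = m≤n⇒m≤1+n (below done∈ y∈done)
  ... | inj₂ y∈ws with ∈-++⁻ w y∈ws
  ...   | inj₁ y∈w         = s≤s (≤-trans (DictSuffix⇒≤ (dict (here refl)) y∈w) (<⇒≤ M<s))
  ...   | inj₂ (here refl) = ≤-refl
... | f′ , ps′ , eq , done′∈ , R≤ =
  f′ , ps′ , cong suc (trans eq (cong (λ d → length ws + length (lzEndGo f′ d ps′ R)) regroup)) ,
  subst (_∈ ps′) regroup done′∈ , R≤
  where
  regroup : (done ++ w ++ [ s ]) ++ separated (suc s) ws ≡ done ++ separated s (w ∷ ws)
  regroup = ++-separated done w s ws

lzEndGo-suffixOfSome : ∀ f done ps R → length R ≤ f → SuffixOfSome R ps → length (lzEndGo f done ps R) ≤ 1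
lzEndGo-suffixOfSome f       done ps []      _  _   = z≤n
lzEndGo-suffixOfSome (suc f) done ps (c ∷ R) le src
  rewrite longestFrom-exact ps (c ∷ R) (suc (length R)) (suc (length R)) ≤-refl
            (λ m R< m≤ → ⊥-elim (<-irrefl refl (<-≤-trans R< m≤)))
            (subst (λ u → SuffixOfSome u ps) (sym (take-all _ (c ∷ R) ≤-refl)) src)
        | ≡ᵇ-refl (length R) = ≤-refl

-- With A = suc n, block n j i (i, j ≤ n) is the interval [n - i + 1, n + j + 2] of the
-- dictionary 1 ⋯ 2A; blocks come row by row (j ascending), within a row with decreasing start.
block : ℕ → ℕ → ℕ → Str
block n j i = range (suc (n ∸ i)) (i + j + 2)

row : ℕ → ℕ → ℕ → List Str
row n j zero    = []
row n j (suc m) = row n j m ++ [ block n j m ]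

rows : ℕ → ℕ → List Str
rows n zero    = []
rows n (suc j) = rows n j ++ row n j (suc n)

blocks : ℕ → List Str
blocks n = rows n (suc n)

block-end : ∀ n j i → i ≤ n → (n ∸ i) + (i + j + 2) ≡ suc n + suc j
block-end n j i i≤n with d , refl ← m≤n⇒∃[o]m+o≡n i≤n rewrite m+n∸m≡n i d = identity i j d
  where
  identity : ∀ i j d → d + (i + j + 2) ≡ suc (i + d) + suc j
  identity = solve-∀

block-lower : ∀ n j i {y} → y ∈ block n j i → suc (n ∸ i) ≤ y
block-lower n j i = range-lower (suc (n ∸ i)) (i + j + 2)

block-upper : ∀ n j i → i ≤ n → ∀ {y} → y ∈ block n j i → y ≤ suc n + suc j
block-upper n j i i≤n y∈ rewrite sym (block-end n j i i≤n) = ≤-pred (range-upper _ _ y∈)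

∈-block : ∀ n j i {y} → i ≤ n → suc (n ∸ i) ≤ y → y ≤ suc n + suc j → y ∈ block n j i
∈-block n j i {y} i≤n lo hi = ∈-range _ _ lo (subst (y <_) (cong suc (sym (block-end n j i i≤n))) (s≤s hi))

block-∋-first : ∀ n j i → i ≤ n → suc (n ∸ i) ∈ block n j i
block-∋-first n j i i≤n = ∈-block n j i i≤n ≤-refl (s≤s (≤-trans (m∸n≤m n i) (m≤m+n n (suc j))))

block-∋-last : ∀ n j i → i ≤ n → suc n + suc j ∈ block n j i
block-∋-last n j i i≤n = ∈-block n j i i≤n (s≤s (≤-trans (m∸n≤m n i) (m≤m+n n (suc j)))) ≤-refl

block-∋-A : ∀ n j i → i ≤ n → suc n ∈ block n j i
block-∋-A n j i i≤n = ∈-block n j i i≤n (s≤s (m∸n≤m n i)) (s≤s (m≤m+n n (suc j)))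

block-∋-A+1 : ∀ n j i → i ≤ n → 2 + n ∈ block n j i
block-∋-A+1 n j i i≤n =
  ∈-block n j i i≤n (s≤s (m≤n⇒m≤1+n (m∸n≤m n i))) (s≤s (m<m+n n z<s))

block-DictSuffix : ∀ n j i → j ≤ n → i ≤ n → DictSuffix (suc n + suc n) (block n j i)
block-DictSuffix n j i j≤n i≤n =
  suc n + suc j , +-monoʳ-≤ (suc n) (s≤s j≤n) , range 1 (n ∸ i) ,
  trans (cong (range 1) (sym (block-end n j i i≤n))) (range-++ 1 (n ∸ i) (i + j + 2))

∈-row : ∀ n j m {w} → w ∈ row n j m → ∃[ i ] (i < m × w ≡ block n j i)
∈-row n j (suc m) w∈ with ∈-++⁻ (row n j m) w∈
... | inj₁ w∈′ with i , i< , refl ← ∈-row n j m w∈′ = i , m≤n⇒m≤1+n i< , refl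
... | inj₂ (here refl) = m , ≤-refl , refl

∈-rows : ∀ n j {w} → w ∈ rows n j → ∃[ j′ ] ∃[ i ] (j′ < j × i ≤ n × w ≡ block n j′ i)
∈-rows n (suc j) w∈ with ∈-++⁻ (rows n j) w∈
... | inj₁ w∈′ with j′ , i , j′< , i≤ , refl ← ∈-rows n j w∈′ =
  j′ , i , m≤n⇒m≤1+n j′< , i≤ , refl
... | inj₂ w∈′ with i , i< , refl ← ∈-row n j (suc n) w∈′ = j , i , ≤-refl , ≤-pred i< , refl

∈-blocks : ∀ n {w} → w ∈ blocks n → ∃[ j ] ∃[ i ] (j ≤ n × i ≤ n × w ≡ block n j i)
∈-blocks n w∈ with j , i , j< , i≤ , refl ← ∈-rows n (suc n) w∈ = j , i , ≤-pred j< , i≤ , refl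

length-row : ∀ n j m → length (row n j m) ≡ m
length-row n j zero    = refl
length-row n j (suc m) = trans (length-++ (row n j m)) (trans (+-comm _ 1) (cong suc (length-row n j m)))

length-rows : ∀ n j → length (rows n j) ≡ j * suc n
length-rows n zero    = refl
length-rows n (suc j) = begin
  length (rows n j ++ row n j (suc n))       ≡⟨ length-++ (rows n j) ⟩
  length (rows n j) + length (row n j (suc n)) ≡⟨ cong₂ _+_ (length-rows n j) (length-row n j (suc n)) ⟩
  j * suc n + suc n                          ≡⟨ +-comm (j * suc n) (suc n) ⟩
  suc j * suc n                              ∎
  where open ≡-Reasoning

length-blocks : ∀ n → length (blocks n) ≡ suc n * suc n
length-blocks n = length-rows n (suc n)

sep₀ : ℕ → ℕ
sep₀ n = suc (suc n + suc n)

block<sep₀ : ∀ n j i → j ≤ n → i ≤ n → ∀ {y} → y ∈ block n j i → y < sep₀ n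
block<sep₀ n j i j≤n i≤n y∈ = s≤s (DictSuffix⇒≤ (block-DictSuffix n j i j≤n i≤n) y∈)

∈-earlier-blocks : ∀ n j m → j ≤ n → m ≤ suc n → ∀ {w} → w ∈ rows n j ++ row n j m →
  ∃[ j′ ] ∃[ i ] (j′ ≤ n × i ≤ n × w ≡ block n j′ i)
∈-earlier-blocks n j m j≤n m≤ w∈ with ∈-++⁻ (rows n j) w∈
... | inj₁ w∈rows with j′ , i , j′<j , i≤n , refl ← ∈-rows n j w∈rows =
  j′ , i , ≤-trans (<⇒≤ j′<j) j≤n , i≤n , refl
... | inj₂ w∈row  with i , i<m , refl ← ∈-row n j m w∈row = j , i , j≤n , ≤-pred (≤-trans i<m m≤) , refl

-- Earlier rows end before block n j m does; earlier blocks of its row start after it does.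
block-⋢-earlier : ∀ n j m → m ≤ n → ∀ {w} → w ∈ rows n j ++ row n j m → ¬ Infix (block n j m) w
block-⋢-earlier n j m m≤n w∈ b⊑w with ∈-++⁻ (rows n j) w∈
... | inj₁ w∈rows with j′ , i , j′<j , i≤n , refl ← ∈-rows n j w∈rows =
  <⇒≱ (+-monoʳ-< (suc n) (s≤s j′<j)) (block-upper n j′ i i≤n (∈-Infix b⊑w (block-∋-last n j m m≤n)))
... | inj₂ w∈row with i , i<m , refl ← ∈-row n j m w∈row =
  <⇒≱ (∸-monoʳ-< i<m m≤n) (≤-pred (block-lower n j i (∈-Infix b⊑w (block-∋-first n j m m≤n))))

module _ (n : ℕ) (D : Str) (D<sep₀ : ∀ {y} → y ∈ D → y < sep₀ n)
         (blocks⋢D : ∀ j i → j ≤ n → i ≤ n → ¬ Infix (block n j i) D) where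

  private
    ctx : Str
    ctx = D ++ [ sep₀ n ]

    s₁ : ℕ
    s₁ = suc (sep₀ n)

  NovelBlocks-next : ∀ j m → j ≤ n → m ≤ n →
    NovelBlocks (ctx ++ separated s₁ (rows n j ++ row n j m)) (s₁ + length (rows n j ++ row n j m)) [ block n j m ]
  NovelBlocks-next j m j≤n m≤n = sep∉ctx , sep∉block , block⋢ctx , tt
    where
    prev : List Str
    prev = rows n j ++ row n j m
    prev<s₁ : ∀ {w} → w ∈ prev → ∀ {y} → y ∈ w → y < s₁
    prev<s₁ w∈ y∈ with j′ , i , j′≤n , i≤n , refl ← ∈-earlier-blocks n j m j≤n (m≤n⇒m≤1+n m≤n) w∈ =
      m≤n⇒m≤1+n (block<sep₀ n j′ i j′≤n i≤n y∈)
    block<s₁ : ∀ {y} → y ∈ block n j m → y < s₁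
    block<s₁ y∈ = m≤n⇒m≤1+n (block<sep₀ n j m j≤n m≤n y∈)
    sep∉ctx : s₁ + length prev ∉ ctx ++ separated s₁ prev
    sep∉ctx sep∈ with ∈-++⁻ ctx sep∈
    ... | inj₁ sep∈ctx with ∈-++⁻ D sep∈ctx
    ...   | inj₁ sep∈D         = <⇒≱ (m≤n⇒m≤1+n (D<sep₀ sep∈D)) (m≤m+n s₁ _)
    ...   | inj₂ (here sep≡)   = <-irrefl (sym sep≡) (m≤m+n s₁ _)
    sep∉ctx sep∈ | inj₂ sep∈sep = <-irrefl refl (separated-upper s₁ prev prev<s₁ sep∈sep)
    sep∉block : s₁ + length prev ∉ block n j m
    sep∉block sep∈ = <⇒≱ (block<s₁ sep∈) (m≤m+n s₁ _)
    block⋢ctx : ¬ Infix (block n j m) (ctx ++ separated s₁ prev)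
    block⋢ctx b⊑ with Infix-split (block n j m) D (sep₀ n) (separated s₁ prev)
                       (subst (Infix (block n j m)) (++-assoc D [ sep₀ n ] _) b⊑)
                       (λ sep∈ → <-irrefl refl (block<sep₀ n j m j≤n m≤n sep∈))
    ... | inj₁ b⊑D   = blocks⋢D j m j≤n m≤n b⊑D
    ... | inj₂ b⊑sep with w , w∈ , b⊑w ← Infix-separated (block n j m) s₁ prev b⊑sep block<s₁
                                           (_ , block-∋-first n j m m≤n) =
      block-⋢-earlier n j m m≤n w∈ b⊑w

  NovelBlocks-rows : ∀ j → j ≤ suc n → NovelBlocks ctx s₁ (rows n j)
  NovelBlocks-row  : ∀ j m → j ≤ n → m ≤ suc n → NovelBlocks ctx s₁ (rows n j ++ row n j m)
  NovelBlocks-rows zero    _   = tt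
  NovelBlocks-rows (suc j) j≤ = NovelBlocks-row j (suc n) (≤-pred j≤) ≤-refl
  NovelBlocks-row j zero    j≤n _  =
    subst (NovelBlocks ctx s₁) (sym (++-identityʳ _)) (NovelBlocks-rows j (m≤n⇒m≤1+n j≤n))
  NovelBlocks-row j (suc m) j≤n m< = subst (NovelBlocks ctx s₁) (++-assoc (rows n j) (row n j m) _)
    (NovelBlocks-snoc ctx s₁ (rows n j ++ row n j m) (block n j m)
      (NovelBlocks-row j m j≤n (m≤n⇒m≤1+n (≤-pred m<))) (NovelBlocks-next j m j≤n (≤-pred m<)))

  zEnd-blocks-≥ : ∀ R → 1 + 2 * (suc n * suc n) ≤ zEnd (D ++ sep₀ n ∷ separated s₁ (blocks n) ++ R)
  zEnd-blocks-≥ R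
    with gs , hs , eq , p , gs≥1 , _
           ← CopyParse-split-at-fresh (lzEnd-parse (D ++ sep₀ n ∷ separated s₁ (blocks n) ++ R))
               D (sep₀ n) _ refl (λ ()) (λ sep∈ → <-irrefl refl (D<sep₀ sep∈)) = begin
    1 + 2 * (suc n * suc n)   ≡⟨ cong (λ l → 1 + 2 * l) (length-blocks n) ⟨
    1 + 2 * length (blocks n) ≤⟨ +-mono-≤ gs≥1 (CopyParse-novel-length (blocks n) s₁ R p refl novel) ⟩
    length gs + length hs     ≡⟨ length-++ gs ⟨
    length (gs ++ hs)         ≡⟨ cong length eq ⟨
    zEnd (D ++ sep₀ n ∷ separated s₁ (blocks n) ++ R) ∎
    where
    open ≤-Reasoning
    novel : NovelBlocks ctx s₁ (blocks n)
    novel = NovelBlocks-rows (suc n) ≤-refl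

-- The texts and their edits

dict : ℕ → Str
dict n = range 1 (suc n + suc n)

separatedBlocks : ℕ → Str
separatedBlocks n = separated (suc (sep₀ n)) (blocks n)

core : ℕ → Str
core n = dict n ++ sep₀ n ∷ separatedBlocks n

pad : ℕ → ℕ → Str
pad n r = drop (length (core n) ∸ r) (core n)

blockPart : ℕ → ℕ → Str
blockPart n r = separatedBlocks n ++ pad n r

withDict : Str → ℕ → ℕ → Str
withDict D n r = D ++ sep₀ n ∷ blockPart n r

text : ℕ → ℕ → Str
text n r = withDict (dict n) n r

pad-SuffixOfSome : ∀ n r {ps} → core n ∈ ps → SuffixOfSome (pad n r) ps
pad-SuffixOfSome n r core∈ = core n , core∈ , take k (core n) , sym (take++drop≡id k (core n))
  where
  k : ℕ
  k = length (core n) ∸ r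

blocks-DictSuffix : ∀ n {w} → w ∈ blocks n → DictSuffix (suc n + suc n) w
blocks-DictSuffix n w∈ with j , i , j≤n , i≤n , refl ← ∈-blocks n w∈ = block-DictSuffix n j i j≤n i≤n

dict-sep₀< : ∀ n {y} → y ∈ dict n ++ [ sep₀ n ] → y < suc (sep₀ n)
dict-sep₀< n y∈ with ∈-++⁻ (dict n) y∈
... | inj₁ y∈dict     = m≤n⇒m≤1+n (range-upper 1 _ y∈dict)
... | inj₂ (here refl) = ≤-refl

module _ (n r : ℕ) where
  private
    ℓ s₁ : ℕ
    ℓ = suc n + suc n
    s₁ = suc (sep₀ n)
    R done : Str
    R = blockPart n r
    done = dict n ++ [ sep₀ n ]

  zEnd-text : ∃[ p ] (p ≤ 1 × zEnd (text n r) ≡ ℓ + suc (suc n * suc n + p))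
  zEnd-text
    with f₁ , ps₁ , eq₁ , below₁ , pre₁ , le₁
           ← lzEndGo-range ℓ 0 (length (text n r)) ([] ∷ []) (sep₀ n ∷ R)
               (λ { (here refl) () }) (λ { zero _ → here refl }) ≤-refl
    with f₂ , refl , le₂ ← fuel-pred [] (sep₀ n) R le₁
    with f₃ , ps₃ , eq₃ , core∈ , le₃
           ← lzEndGo-separated ℓ (blocks n) s₁ f₂ done (ps₁ ++ [ done ]) (pad n r)
               (m≤n⇒m≤1+n (n<1+n ℓ)) (AllBelow-snoc below₁ (dict-sep₀< n))
               (λ t t≤ → ∈-++⁺ˡ (pre₁ t t≤)) (∈-++⁺ʳ ps₁ (here refl)) (blocks-DictSuffix n) le₂
    = p , p≤1 , (begin
        zEnd (text n r)                                         ≡⟨ eq₁ ⟩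
        ℓ + length (lzEndGo (suc f₂) (dict n) ps₁ (sep₀ n ∷ R))  ≡⟨ cong (λ z → ℓ + length z) separator-step ⟩
        ℓ + suc (length (lzEndGo f₂ done (ps₁ ++ [ done ]) R))   ≡⟨ cong (λ z → ℓ + suc z) eq₃ ⟩
        ℓ + suc (length (blocks n) + p)                         ≡⟨ cong (λ z → ℓ + suc (z + p)) (length-blocks n) ⟩
        ℓ + suc (suc n * suc n + p)                             ∎)
    where
    open ≡-Reasoning
    separator-step : lzEndGo (suc f₂) (dict n) ps₁ (sep₀ n ∷ R)
                       ≡ [ sep₀ n ] ∷ lzEndGo f₂ done (ps₁ ++ [ done ]) R
    separator-step = lzEndGo-fresh-step f₂ (dict n) ps₁ [] (sep₀ n) R
                       (AllBelow⇒fresh below₁) ([] , pre₁ 0 z≤n , [] , refl)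
    p : ℕ
    p = length (lzEndGo f₃ (done ++ separated s₁ (blocks n)) ps₃ (pad n r))
    p≤1 : p ≤ 1
    p≤1 = lzEndGo-suffixOfSome f₃ _ ps₃ (pad n r) le₃
            (pad-SuffixOfSome n r (subst (_∈ ps₃) (++-assoc (dict n) [ sep₀ n ] _) core∈))

zEnd-text-≤ : ∀ n r → zEnd (text n r) ≤ suc n + suc n + suc (suc n * suc n + 1)
zEnd-text-≤ n r with p , p≤1 , eq ← zEnd-text n r rewrite eq =
  +-monoʳ-≤ (suc n + suc n) (s≤s (+-monoʳ-≤ (suc n * suc n) p≤1))

zEnd-text-≥ : ∀ n r → suc n + suc n + suc (suc n * suc n) ≤ zEnd (text n r)
zEnd-text-≥ n r with p , _ , eq ← zEnd-text n r rewrite eq =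
  +-monoʳ-≤ (suc n + suc n) (s≤s (m≤m+n (suc n * suc n) p))

-- The edit destroys the dictionary symbol A + 1 = suc (suc n) (substituted or deleted), or,
-- for an insertion, separates it from A; every block contains both A and A + 1.
edited : EditOp → ℕ → Str
edited sub n = range 1 (suc n) ++ 0 ∷ range (3 + n) n
edited ins n = range 1 (suc n) ++ 0 ∷ range (2 + n) (suc n)
edited del n = range 1 (suc n) ++ range (3 + n) n

text′ : EditOp → ℕ → ℕ → Str
text′ x n r = withDict (edited x n) n r

dict-split : ∀ n → dict n ≡ range 1 (suc n) ++ (2 + n) ∷ range (3 + n) n
dict-split n = range-++ 1 (suc n) (suc n)

text-split : ∀ n r → text n r ≡ range 1 (suc n) ++ (2 + n) ∷ range (3 + n) n ++ sep₀ n ∷ blockPart n r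
text-split n r = trans (cong (_++ sep₀ n ∷ blockPart n r) (dict-split n)) (++-assoc (range 1 (suc n)) _ _)

text′-OneEdit : ∀ x n r → OneEdit x (text n r) (text′ x n r)
text′-OneEdit sub n r =
  range 1 (suc n) , 2 + n , 0 , range (3 + n) n ++ sep₀ n ∷ blockPart n r , (λ ()) ,
  text-split n r , ++-assoc (range 1 (suc n)) _ _
text′-OneEdit ins n r =
  range 1 (suc n) , 0 , (2 + n) ∷ range (3 + n) n ++ sep₀ n ∷ blockPart n r ,
  text-split n r , ++-assoc (range 1 (suc n)) _ _
text′-OneEdit del n r =
  range 1 (suc n) , 2 + n , range (3 + n) n ++ sep₀ n ∷ blockPart n r ,
  text-split n r , ++-assoc (range 1 (suc n)) _ _

low<sep₀ : ∀ n {y} → y ∈ range 1 (suc n) → y < sep₀ n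
low<sep₀ n y∈ = ≤-trans (range-upper 1 (suc n) y∈) (s≤s (s≤s (m≤m+n n (suc n))))

high<sep₀ : ∀ n {y} → y ∈ range (3 + n) n → y < sep₀ n
high<sep₀ n {y} y∈ = subst (y <_) (cong (2 +_) (sym (+-suc n n))) (range-upper (3 + n) n y∈)

edited<sep₀ : ∀ x n {y} → y ∈ edited x n → y < sep₀ n
edited<sep₀ sub n y∈ with ∈-++⁻ (range 1 (suc n)) y∈
... | inj₁ y∈low          = low<sep₀ n y∈low
... | inj₂ (here refl)    = z<s
... | inj₂ (there y∈high) = high<sep₀ n y∈high
edited<sep₀ ins n y∈ with ∈-++⁻ (range 1 (suc n)) y∈
... | inj₁ y∈low          = low<sep₀ n y∈low
... | inj₂ (here refl)    = z<s
... | inj₂ (there y∈high) = range-upper (2 + n) (suc n) y∈high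
edited<sep₀ del n y∈ with ∈-++⁻ (range 1 (suc n)) y∈
... | inj₁ y∈low  = low<sep₀ n y∈low
... | inj₂ y∈high = high<sep₀ n y∈high

blocks⋢edited : ∀ x n j i → j ≤ n → i ≤ n → ¬ Infix (block n j i) (edited x n)
blocks⋢edited sub n j i j≤n i≤n b⊑ with ∈-++⁻ (range 1 (suc n)) (∈-Infix b⊑ (block-∋-A+1 n j i i≤n))
... | inj₁ ∈low          = <-irrefl refl (range-upper 1 (suc n) ∈low)
... | inj₂ (there ∈high) = <⇒≱ ≤-refl (range-lower (3 + n) n ∈high)
blocks⋢edited del n j i j≤n i≤n b⊑ with ∈-++⁻ (range 1 (suc n)) (∈-Infix b⊑ (block-∋-A+1 n j i i≤n))
... | inj₁ ∈low  = <-irrefl refl (range-upper 1 (suc n) ∈low)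
... | inj₂ ∈high = <⇒≱ ≤-refl (range-lower (3 + n) n ∈high)
blocks⋢edited ins n j i j≤n i≤n b⊑
  with Infix-split (block n j i) (range 1 (suc n)) 0 (range (2 + n) (suc n)) b⊑
         (λ 0∈ → <⇒≱ z<s (block-lower n j i 0∈))
... | inj₁ b⊑low  = <-irrefl refl (range-upper 1 (suc n) (∈-Infix b⊑low (block-∋-A+1 n j i i≤n)))
... | inj₂ b⊑high = <⇒≱ ≤-refl (range-lower (2 + n) (suc n) (∈-Infix b⊑high (block-∋-A n j i i≤n)))

zEnd-text′-≥ : ∀ x n r → 1 + 2 * (suc n * suc n) ≤ zEnd (text′ x n r)
zEnd-text′-≥ x n r = zEnd-blocks-≥ n (edited x n) (edited<sep₀ x n) (blocks⋢edited x n) (pad n r)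

weight : List Str → ℕ
weight ws = sum (map (λ w → suc (length w)) ws)

weight-++ : ∀ xs ys → weight (xs ++ ys) ≡ weight xs + weight ys
weight-++ xs ys = trans (cong sum (map-++ _ xs ys)) (sum-++ (map _ xs) _)

length-separated : ∀ s ws → length (separated s ws) ≡ weight ws
length-separated s []       = refl
length-separated s (w ∷ ws) = begin
  length (w ++ s ∷ separated (suc s) ws)    ≡⟨ length-++ w ⟩
  length w + suc (length (separated (suc s) ws)) ≡⟨ +-suc (length w) _ ⟩
  suc (length w + length (separated (suc s) ws)) ≡⟨ cong (λ l → suc (length w + l)) (length-separated (suc s) ws) ⟩
  weight (w ∷ ws)                           ∎
  where open ≡-Reasoning

weight-row : ∀ n j m → 2 * weight (row n j m) ≡ m * (m + 2 * j + 5)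
weight-row n j zero    = refl
weight-row n j (suc m) = begin
  2 * weight (row n j m ++ [ block n j m ])                 ≡⟨ cong (2 *_) (weight-++ (row n j m) _) ⟩
  2 * (weight (row n j m) + (suc (length (block n j m)) + 0)) ≡⟨ *-distribˡ-+ 2 (weight (row n j m)) _ ⟩
  2 * weight (row n j m) + 2 * (suc (length (block n j m)) + 0)
      ≡⟨ cong₂ (λ w l → w + 2 * (suc l + 0)) (weight-row n j m) (length-range _ (m + j + 2)) ⟩
  m * (m + 2 * j + 5) + 2 * (suc (m + j + 2) + 0)           ≡⟨ identity m j ⟩
  suc m * (suc m + 2 * j + 5)                                ∎
  where
  open ≡-Reasoning
  identity : ∀ m j → m * (m + 2 * j + 5) + 2 * (suc (m + j + 2) + 0) ≡ suc m * (suc m + 2 * j + 5)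
  identity = solve-∀

weight-rows : ∀ n j → 2 * weight (rows n j) ≡ suc n * j * (suc n + j + 4)
weight-rows n zero    = sym (cong (_* (suc n + 0 + 4)) (*-zeroʳ (suc n)))
weight-rows n (suc j) = begin
  2 * weight (rows n j ++ row n j (suc n))                 ≡⟨ cong (2 *_) (weight-++ (rows n j) _) ⟩
  2 * (weight (rows n j) + weight (row n j (suc n)))       ≡⟨ *-distribˡ-+ 2 (weight (rows n j)) _ ⟩
  2 * weight (rows n j) + 2 * weight (row n j (suc n))     ≡⟨ cong₂ _+_ (weight-rows n j) (weight-row n j (suc n)) ⟩
  suc n * j * (suc n + j + 4) + suc n * (suc n + 2 * j + 5) ≡⟨ identity (suc n) j ⟩
  suc n * suc j * (suc n + suc j + 4)                      ∎
  where
  open ≡-Reasoning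
  identity : ∀ a j → a * j * (a + j + 4) + a * (a + 2 * j + 5) ≡ a * suc j * (a + suc j + 4)
  identity = solve-∀

weight-blocks : ∀ n → weight (blocks n) ≡ suc n * suc n * (suc n + 2)
weight-blocks n = *-cancelˡ-≡ _ _ 2 (trans (weight-rows n (suc n)) (identity (suc n)))
  where
  identity : ∀ a → a * a * (a + a + 4) ≡ 2 * (a * a * (a + 2))
  identity = solve-∀

coreLength : ℕ → ℕ
coreLength A = A + A + suc (A * A * (A + 2))

length-core : ∀ n → length (core n) ≡ coreLength (suc n)
length-core n = begin
  length (dict n ++ sep₀ n ∷ separatedBlocks n)       ≡⟨ length-++ (dict n) ⟩
  length (dict n) + suc (length (separatedBlocks n)) ≡⟨ cong₂ (λ d b → d + suc b) (length-range 1 (suc n + suc n))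
                                                          (length-separated (suc (sep₀ n)) (blocks n)) ⟩
  suc n + suc n + suc (weight (blocks n))            ≡⟨ cong (λ b → suc n + suc n + suc b) (weight-blocks n) ⟩
  coreLength (suc n)                                 ∎
  where open ≡-Reasoning

length-text : ∀ n r → r ≤ length (core n) → length (text n r) ≡ coreLength (suc n) + r
length-text n r r≤ = begin
  length (text n r)                  ≡⟨ cong length (++-assoc (dict n) (sep₀ n ∷ separatedBlocks n) (pad n r)) ⟨
  length (core n ++ pad n r)         ≡⟨ length-++ (core n) ⟩
  length (core n) + length (pad n r) ≡⟨ cong (length (core n) +_) (length-drop (length (core n) ∸ r) (core n)) ⟩
  length (core n) + (length (core n) ∸ (length (core n) ∸ r)) ≡⟨ cong (length (core n) +_) (m∸[m∸n]≡n r≤) ⟩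
  length (core n) + r                ≡⟨ cong (_+ r) (length-core n) ⟩
  coreLength (suc n) + r             ∎
  where open ≡-Reasoning

≤-offset : ∀ {m n} k → m + k ≡ n → m ≤ n
≤-offset {m} k refl = m≤m+n m k

coreLength-< : ∀ a → coreLength a < coreLength (suc a)
coreLength-< a = ≤-offset (3 * a * a + 7 * a + 4) (identity a)
  where
  identity : ∀ a → suc (a + a + suc (a * a * (a + 2))) + (3 * a * a + 7 * a + 4)
                   ≡ suc a + suc a + suc (suc a * suc a * (suc a + 2))
  identity = solve-∀

bracket : ∀ (f : ℕ → ℕ) → (∀ a → f a < f (suc a)) → ∀ N m → f N ≤ m →
  ∃[ a ] (N ≤ a × f a ≤ m × m < f (suc a))
bracket f f< N zero    fN≤0 = N , ≤-refl , fN≤0 , ≤-<-trans z≤n (f< N)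
bracket f f< N (suc m) fN≤ with f N ≤? m
... | no fN≰m = N , ≤-refl , fN≤ , ≤-<-trans (≰⇒> fN≰m) (f< N)
... | yes fN≤m with a , N≤a , fa≤m , m<fa′ ← bracket f f< N m fN≤m with suc m <? f (suc a)
...   | yes m<fa′′ = a , N≤a , m≤n⇒m≤1+n fa≤m , m<fa′′
...   | no m≮fa′   = suc a , m≤n⇒m≤1+n N≤a , ≮⇒≥ m≮fa′ , ≤-<-trans m<fa′ (f< (suc a))

coreLength-doubling : ∀ u →
  coreLength (5 + u) + (u * u * u + 11 * u * u + 35 * u + 24) ≡ coreLength (4 + u) + coreLength (4 + u)
coreLength-doubling = identity
  where
  identity : ∀ u → (5 + u + (5 + u) + suc ((5 + u) * (5 + u) * (5 + u + 2)))
                     + (u * u * u + 11 * u * u + 35 * u + 24)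
                   ≡ (4 + u + (4 + u) + suc ((4 + u) * (4 + u) * (4 + u + 2)))
                     + (4 + u + (4 + u) + suc ((4 + u) * (4 + u) * (4 + u + 2)))
  identity = solve-∀

text-of-length : ∀ N n′ → coreLength (4 + N) ≤ n′ →
  ∃[ t ] ∃[ r ] (length (text (3 + N + t) r) ≡ n′ × n′ < coreLength (5 + N + t))
text-of-length N n′ c≤n′
  with a , N≤a , ca≤n′ , n′<ca′ ← bracket coreLength coreLength-< (4 + N) n′ c≤n′
  with t , refl ← m≤n⇒∃[o]m+o≡n N≤a =
  t , n′ ∸ c , trans (length-text (3 + N + t) (n′ ∸ c) r≤) (m+[n∸m]≡n ca≤n′) , n′<ca′
  where
  c : ℕ
  c = coreLength (4 + N + t)
  r≤ : n′ ∸ c ≤ length (core (3 + N + t))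
  r≤ = begin
    n′ ∸ c        ≤⟨ ∸-monoˡ-≤ c (≤-trans (<⇒≤ n′<ca′) (≤-offset _ (coreLength-doubling (N + t)))) ⟩
    (c + c) ∸ c   ≡⟨ m+n∸m≡n c c ⟩
    c             ≡⟨ length-core (3 + N + t) ⟨
    length (core (3 + N + t)) ∎
    where open ≤-Reasoning

ms-identity : ∀ k t →
  (2 * k + 1) * ((4 + 4 * k + t) + (4 + 4 * k + t) + suc ((4 + 4 * k + t) * (4 + 4 * k + t) + 1))
    + (t * t + 4 * k * t + 6 * t + 5 * k + 7)
  ≡ (k + 1) * (1 + 2 * ((4 + 4 * k + t) * (4 + 4 * k + t)))
ms-identity = solve-∀

ms-ratio : ∀ x k t r → let n = 3 + 4 * k + t in
  (2 * k + 1) * zEnd (text n r) ≤ (k + 1) * zEnd (text′ x n r)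
ms-ratio x k t r =
  ≤-trans (*-monoʳ-≤ (2 * k + 1) (zEnd-text-≤ (3 + 4 * k + t) r))
    (≤-trans (≤-offset (t * t + 4 * k * t + 6 * t + 5 * k + 7) (ms-identity k t))
      (*-monoʳ-≤ (k + 1) (zEnd-text′-≥ x (3 + 4 * k + t) r)))

MS-liminf-≥2 : ∀ x k → ∃[ N ] ∀ n′ → N ≤ n′ → ∃[ T ] ∃[ T′ ] (length T ≡ n′ × OneEdit x T T′
                 × (2 * k + 1) * zEnd T ≤ (k + 1) * zEnd T′)
MS-liminf-≥2 x k = coreLength (4 + 4 * k) , λ n′ c≤n′ → witness (text-of-length (4 * k) n′ c≤n′)
  where
  witness : ∀ {n′} → ∃[ t ] ∃[ r ] (length (text (3 + 4 * k + t) r) ≡ n′ × n′ < coreLength (5 + 4 * k + t)) →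
    ∃[ T ] ∃[ T′ ] (length T ≡ n′ × OneEdit x T T′ × (2 * k + 1) * zEnd T ≤ (k + 1) * zEnd T′)
  witness (t , r , len , _) = text n r , text′ x n r , len , text′-OneEdit x n r , ms-ratio x k t r
    where
    n : ℕ
    n = 3 + 4 * k + t

^2≡* : ∀ n → n ^ 2 ≡ n * n
^2≡* n = cong (n *_) (*-identityʳ n)

as-z-identity : ∀ A → (1 + 2 * (A * A)) + (4 * A + 3) ≡ 2 * (A + A + suc (A * A + 1))
as-z-identity = solve-∀

as-z-square-identity : ∀ A → (4 * A + 3) * (4 * A + 3) + (9 * A * A + 26 * A + 16) ≡ 5 * 5 * (A + A + suc (A * A))
as-z-square-identity = solve-∀

as-z-gap : ∀ x m → 2 * zEnd (text m 0) ∸ zEnd (text′ x m 0) ≤ 4 * suc m + 3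
as-z-gap x m = begin
  2 * zEnd (text m 0) ∸ zEnd (text′ x m 0)        ≤⟨ ∸-mono (*-monoʳ-≤ 2 (zEnd-text-≤ m 0)) (zEnd-text′-≥ x m 0) ⟩
  2 * (A + A + suc (A * A + 1)) ∸ (1 + 2 * (A * A)) ≡⟨ cong (_∸ (1 + 2 * (A * A))) (as-z-identity A) ⟨
  (1 + 2 * (A * A)) + (4 * A + 3) ∸ (1 + 2 * (A * A)) ≡⟨ m+n∸m≡n (1 + 2 * (A * A)) _ ⟩
  4 * A + 3                                        ∎
  where
  open ≤-Reasoning
  A : ℕ
  A = suc m

AS-≥-z-√z : ∀ x → ∃[ c ] ∀ m → ∃[ T ] ∃[ T′ ] (m ≤ zEnd T × OneEdit x T T′
                × (2 * zEnd T ∸ zEnd T′) ^ 2 ≤ c * c * zEnd T)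
AS-≥-z-√z x = 5 , λ m → text m 0 , text′ x m 0 , large m , text′-OneEdit x m 0 , gap² m
  where
  large : ∀ m → m ≤ zEnd (text m 0)
  large m = ≤-trans (n≤1+n m)
              (≤-trans (m≤m+n (suc m) (suc m)) (≤-trans (m≤m+n (suc m + suc m) _) (zEnd-text-≥ m 0)))
  gap² : ∀ m → (2 * zEnd (text m 0) ∸ zEnd (text′ x m 0)) ^ 2 ≤ 5 * 5 * zEnd (text m 0)
  gap² m = begin
    (2 * zEnd (text m 0) ∸ zEnd (text′ x m 0)) ^ 2 ≡⟨ ^2≡* (2 * zEnd (text m 0) ∸ zEnd (text′ x m 0)) ⟩
    (2 * zEnd (text m 0) ∸ zEnd (text′ x m 0)) * (2 * zEnd (text m 0) ∸ zEnd (text′ x m 0))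
                                                   ≤⟨ *-mono-≤ (as-z-gap x m) (as-z-gap x m) ⟩
    (4 * suc m + 3) * (4 * suc m + 3)              ≤⟨ ≤-offset _ (as-z-square-identity (suc m)) ⟩
    5 * 5 * (suc m + suc m + suc (suc m * suc m))  ≤⟨ *-monoʳ-≤ (5 * 5) (zEnd-text-≥ m 0) ⟩
    5 * 5 * zEnd (text m 0)                        ∎
    where open ≤-Reasoning

as-n-identity : ∀ t →
  (4 + t + (4 + t) + suc ((4 + t) * (4 + t) + 1)) + (t * t + 6 * t + 7) ≡ 1 + 2 * ((4 + t) * (4 + t))
as-n-identity = solve-∀

as-n-length-identity : ∀ t →
  (5 + t + (5 + t) + suc ((5 + t) * (5 + t) * (5 + t + 2)))
    + (27 * t * t * t * t + 323 * t * t * t + 1333 * t * t + 2171 * t + 1137)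
  ≡ 27 * ((t * t + 6 * t + 7) * (t * t + 6 * t + 7))
as-n-length-identity = solve-∀

as-n-gap : ∀ x t r → t * t + 6 * t + 7 ≤ zEnd (text′ x (3 + t) r) ∸ zEnd (text (3 + t) r)
as-n-gap x t r = begin
  t * t + 6 * t + 7                      ≡⟨ m+n∸m≡n zU _ ⟨
  zU + (t * t + 6 * t + 7) ∸ zU          ≡⟨ cong (_∸ zU) (as-n-identity t) ⟩
  (1 + 2 * ((4 + t) * (4 + t))) ∸ zU     ≤⟨ ∸-mono (zEnd-text′-≥ x (3 + t) r) (zEnd-text-≤ (3 + t) r) ⟩
  zEnd (text′ x (3 + t) r) ∸ zEnd (text (3 + t) r) ∎
  where
  open ≤-Reasoning
  zU : ℕ
  zU = 4 + t + (4 + t) + suc ((4 + t) * (4 + t) + 1)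

AS-Ω-√n : ∀ x → ∃[ d ] ∃[ N ] ∀ n′ → N ≤ n′ → ∃[ T ] ∃[ T′ ] (length T ≡ n′ × OneEdit x T T′
            × n′ ≤ d * (zEnd T′ ∸ zEnd T) ^ 2)
AS-Ω-√n x = 27 , coreLength 4 , λ n′ c≤n′ → witness (text-of-length 0 n′ c≤n′)
  where
  witness : ∀ {n′} → ∃[ t ] ∃[ r ] (length (text (3 + t) r) ≡ n′ × n′ < coreLength (5 + t)) →
    ∃[ T ] ∃[ T′ ] (length T ≡ n′ × OneEdit x T T′ × n′ ≤ 27 * (zEnd T′ ∸ zEnd T) ^ 2)
  witness {n′} (t , r , len , n′<) =
    text (3 + t) r , text′ x (3 + t) r , len , text′-OneEdit x (3 + t) r , (begin
    n′                                   ≤⟨ <⇒≤ n′< ⟩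
    coreLength (5 + t)                   ≤⟨ ≤-offset _ (as-n-length-identity t) ⟩
    27 * ((t * t + 6 * t + 7) * (t * t + 6 * t + 7))
                                         ≤⟨ *-monoʳ-≤ 27 (*-mono-≤ (as-n-gap x t r) (as-n-gap x t r)) ⟩
    27 * (gap * gap)                     ≡⟨ cong (27 *_) (^2≡* gap) ⟨
    27 * gap ^ 2                         ∎)
    where
    open ≤-Reasoning
    gap : ℕ
    gap = zEnd (text′ x (3 + t) r) ∸ zEnd (text (3 + t) r)

theorem22 : (x : EditOp) →
    (∀ (k : ℕ) → ∃[ N ] ∀ (n : ℕ) → N ≤ n →
       ∃[ T ] ∃[ T' ] (length T ≡ n × OneEdit x T T'
         × (2 * k + 1) * zEnd T ≤ (k + 1) * zEnd T'))
    × (∃[ c ] ∀ (m : ℕ) → ∃[ T ] ∃[ T' ]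
         (m ≤ zEnd T × OneEdit x T T'
           × (2 * zEnd T ∸ zEnd T') ^ 2 ≤ c * c * zEnd T))
    × (∃[ d ] ∃[ N ] ∀ (n : ℕ) → N ≤ n →
         ∃[ T ] ∃[ T' ] (length T ≡ n × OneEdit x T T'
           × n ≤ d * (zEnd T' ∸ zEnd T) ^ 2))
theorem22 x = MS-liminf-≥2 x , AS-≥-z-√z x , AS-Ω-√n x
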